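{- Let $n\ge2$ and let $\alpha=[0;1+d_1,\overline{d_2,\ldots,d_n}]$ be irrational with positive integers $d_n\ge d_1\ge1$ (extend $d_i=d_{i+n-1}$ for $i\ge2$). Define $s_{ -1}=b$, $s_0=a$, $s_j=s_{j-1}^{d_j}s_{j-2}$ ($j\ge1$), let $\sigma$ be the morphism with $\sigma(a)=s_{n-1}$, $\sigma(b)=s_{n-1}^{d_n-d_1}s_{n-2}$, and let $E$ be the morphism exchanging $a$ and $b$. Then (i) $c_\alpha=\lim_{m\to\infty}\sigma^m(a)=\sigma^\omega(a)$; (ii) $c_{1-\alpha}=\lim_{m\to\infty}\hat\sigma^m(b)=\hat\sigma^\omega(b)$, where $\hat\sigma=E\sigma E$.
   Context: For irrational $\gamma\in(0,1)$, the characteristic Sturmian word $c_\gamma=c_\gamma(0)c_\gamma(1)\cdots$ over $\{a,b\}$ is defined by $c_\gamma(i)=a$ if $\lfloor (i+2)\gamma\rfloor-\lfloor (i+1)\gamma\rfloor=0$ and $c_\gamma(i)=b$ otherwise ($i\ge0$). If $\psi$ is a morphism and $c$ a letter with $\psi(c)=cw$, $w$ nonempty, then $\psi^m(c)$ is a proper prefix of $\psi^{m+1}(c)$ and $\psi^\omega(c)=\lim_m\psi^m(c)$ is the infinite word having every $\psi^m(c)$ as a prefix; a limit of finite words, each a prefix of the next, is the infinite word having all of them as prefixes. -}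

module Defs where

open import Data.Nat as ℕ using (ℕ; zero; suc; _∸_)
open import Data.Integer as ℤ using (ℤ; +_)
open import Data.Rational.Unnormalised as Q using (ℚᵘ; mkℚᵘ; 0ℚᵘ; 1ℚᵘ)
open import Data.List using (List; []; _∷_; _++_; concatMap; map; length; lookup)
open import Data.Product using (Σ; ∃; _×_; _,_)
open import Data.Empty using (⊥)
open import Relation.Nullary using (¬_)
open import Relation.Binary.PropositionalEquality using (_≡_)

data Letter : Set where
  a b : Letter

Word : Set
Word = List Letter

Morphism : Set
Morphism = Letter → Word

apply : Morphism → Word → Word
apply f w = concatMap f w

iter : Morphism → ℕ → Word → Word
iter f zero    w = w
iter f (suc m) w = apply f (iter f m w)

pow : Word → ℕ → Word
pow w zero    = []
pow w (suc k) = w ++ pow w k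

swap : Letter → Letter
swap a = b
swap b = a

E : Morphism
E x = swap x ∷ []

_∘ₘ_ : Morphism → Morphism → Morphism
(f ∘ₘ g) x = apply f (g x)

-- The words s_j.  S k = s_{k-1}, i.e. S 0 = s_{-1} = b, S 1 = s_0 = a,
-- s_j = s_{j-1}^{d_j} s_{j-2}  (j ≥ 1).

S : (ℕ → ℕ) → ℕ → Word
S d zero                = b ∷ []
S d (suc zero)          = a ∷ []
S d (suc (suc j))       = pow (S d (suc j)) (d (suc j)) ++ S d j

s : (ℕ → ℕ) → ℕ → Word
s d j = S d (suc j)

σ : (ℕ → ℕ) → ℕ → Morphism
σ d n a = S d n
σ d n b = pow (S d n) (d n ∸ d 1) ++ S d (n ∸ 1)

σ̂ : (ℕ → ℕ) → ℕ → Morphism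
σ̂ d n = E ∘ₘ (σ d n ∘ₘ E)

-- Real numbers, represented by sequences of rationals (the real is the
-- limit of the sequence).  Order: x < y iff eventually y exceeds x by a
-- fixed positive rational (Bishop's definition).

RealSeq : Set
RealSeq = ℕ → ℚᵘ

_<ᵣ_ : RealSeq → RealSeq → Set
x <ᵣ y = Σ ℚᵘ λ ε → (0ℚᵘ Q.< ε) × Σ ℕ λ N → ∀ k → N ℕ.≤ k → (x k Q.+ ε) Q.≤ y k

_≤ᵣ_ : RealSeq → RealSeq → Set
x ≤ᵣ y = ¬ (y <ᵣ x)

_≈ᵣ_ : RealSeq → RealSeq → Set
x ≈ᵣ y = (x ≤ᵣ y) × (y ≤ᵣ x)

const : ℚᵘ → RealSeq
const q k = q

intR : ℤ → RealSeq
intR m = const (m Q./ 1)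

_·ᵣ_ : ℕ → RealSeq → RealSeq
(k ·ᵣ x) i = ((+ k) Q./ 1) Q.* x i

oneMinus : RealSeq → RealSeq
oneMinus x i = 1ℚᵘ Q.- x i

Irrational : RealSeq → Set
Irrational x = ∀ (p : ℤ) (q : ℕ) .{{_ : ℕ.NonZero q}} → ¬ (x ≈ᵣ const (p Q./ q))

IsFloor : RealSeq → ℤ → Set
IsFloor x m = (intR m ≤ᵣ x) × (x <ᵣ intR (m ℤ.+ ℤ.+ 1))

SameFloor : RealSeq → ℕ → Set
SameFloor γ i = Σ ℤ λ m → IsFloor ((suc (suc i)) ·ᵣ γ) m × IsFloor ((suc i) ·ᵣ γ) m

IsCharLetter : RealSeq → ℕ → Letter → Set
IsCharLetter γ i a = SameFloor γ i
IsCharLetter γ i b = ¬ SameFloor γ i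

-- The continued fraction α = [0; 1+d_1, d_2, d_3, ...]  (partial quotients
-- a_1 = 1 + d_1, a_k = d_k for k ≥ 2) and its convergents p_k / q_k.
-- P k = p_{k-1}, Q k = q_{k-1}:  p_{-1} = 1, p_0 = 0, q_{-1} = 0, q_0 = 1.

pq : (ℕ → ℕ) → ℕ → ℕ
pq d zero       = 1
pq d (suc zero) = 1 ℕ.+ d 1
pq d (suc (suc k)) = d (suc (suc k))

P : (ℕ → ℕ) → ℕ → ℕ
P d zero = 1
P d (suc zero) = 0
P d (suc (suc k)) = pq d (suc k) ℕ.* P d (suc k) ℕ.+ P d k

Qd : (ℕ → ℕ) → ℕ → ℕ
Qd d zero = 0
Qd d (suc zero) = 1
Qd d (suc (suc k)) = pq d (suc k) ℕ.* Qd d (suc k) ℕ.+ Qd d k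

-- k-th convergent p_k / q_k (k ≥ 0); q_k ≥ 1 so the denominator is q_k
convergent : (ℕ → ℕ) → ℕ → ℚᵘ
convergent d k = mkℚᵘ (+ P d (suc k)) (Qd d (suc k) ∸ 1)

cfValue : (ℕ → ℕ) → RealSeq
cfValue d = convergent d

-- "lim_m ψ^m(c) = ψ^ω(c) and it equals c_γ":
-- ψ(c) = c w with w nonempty (so ψ^m(c) is a proper prefix of ψ^{m+1}(c)),
-- the lengths |ψ^m(c)| are unbounded (so the limit is an infinite word),
-- and every letter of every ψ^m(c) is the corresponding letter of c_γ.

IsFixedPointOf : Morphism → Letter → RealSeq → Set
IsFixedPointOf ψ c γ =
  (Σ Letter λ x → Σ Word λ w → ψ c ≡ c ∷ x ∷ w)
  × (∀ N → Σ ℕ λ m → N ℕ.≤ length (iter ψ m (c ∷ [])))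
  × (∀ m (i : Data.Fin.Fin (length (iter ψ m (c ∷ [])))) →
       IsCharLetter γ (Data.Fin.toℕ i) (lookup (iter ψ m (c ∷ [])) i))
  where import Data.Fin

-- α is the limit of its convergents p_k/q_k, which lie alternately below and above α with
-- p_{k+1} q_k − p_k q_{k+1} = ±1. For j < q_K + q_{K+1} no integer lies strictly between j p_K/q_K
-- and jα (Farey neighbours), so p_K/q_K already determines ⌊jα⌋, and the recurrence of the
-- convergents keeps j p_k/q_k a fixed distance away from the neighbouring integers for all later k.
-- Moving j by t q_K moves ⌊jα⌋ by t p_K; since s_{K+1} = s_K^{d_{K+1}} s_{K−1} and |s_K| = q_K, this
-- shows by induction that every s_K is a prefix of c_α. Finally σ = θ ∘ μ, where μ = (a ↦ a, b ↦
-- a^{dₙ−d₁} b) replaces d₁ by dₙ and θ = (a ↦ s_{n−1}, b ↦ s_{n−2}), so by periodicity σ(s_k) =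
-- s_{k+n−1} and σ^m(a) = s_{m(n−1)}. Part (ii) follows by applying E, since ⌊j(1 − α)⌋ = j − 1 − ⌊jα⌋.

module Submission where

open import Data.Nat
  using (ℕ; zero; suc; _+_; _*_; _∸_; _≤_; _<_; _⊔_; z≤n; s≤s; _≤?_; _≟_; >-nonZero; s≤s⁻¹)
open import Data.Nat.Properties
open import Data.Nat.Induction using (<-rec)
open import Data.Nat.DivMod using (_/_; _%_; m≡m%n+[m/n]*n; m%n<n)
open import Data.Nat.Tactic.RingSolver using (solve-∀)
open import Data.Integer as ℤ using (+≤+; +<+)
import Data.Integer.Properties as ℤP
open import Data.Rational.Unnormalised as ℚ using (mkℚᵘ; 1ℚᵘ; *≤*; *<*)
import Data.Rational.Unnormalised.Properties as ℚP
open import Data.List using (List; []; _∷_; _++_; length; lookup)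
open import Data.List.Properties using (++-assoc; ++-identityʳ; length-++; concatMap-++; concatMap-cong)
open import Data.Fin using (Fin; toℕ)
import Data.Fin as Fin
open import Data.Maybe using (Maybe; just; nothing)
open import Data.Product using (Σ; _×_; _,_; proj₁; proj₂)
open import Data.Sum using (_⊎_; inj₁; inj₂)
import Data.Sum as Sum
open import Data.Empty using (⊥-elim)
open import Relation.Nullary using (¬_; yes; no)
open import Relation.Binary.PropositionalEquality
open import Relation.Binary.Definitions using (tri<; tri≈; tri>)

open import Defs

apply-++ : ∀ f u v → apply f (u ++ v) ≡ apply f u ++ apply f v
apply-++ f = concatMap-++ f

apply-cong : ∀ {f g} → (∀ x → f x ≡ g x) → ∀ w → apply f w ≡ apply g w
apply-cong f≗g = concatMap-cong f≗g

apply-∘ₘ : ∀ f g w → apply (f ∘ₘ g) w ≡ apply f (apply g w)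
apply-∘ₘ f g []      = refl
apply-∘ₘ f g (x ∷ w) = begin
  apply f (g x) ++ apply (f ∘ₘ g) w  ≡⟨ cong (apply f (g x) ++_) (apply-∘ₘ f g w) ⟩
  apply f (g x) ++ apply f (apply g w) ≡⟨ apply-++ f (g x) (apply g w) ⟨
  apply f (g x ++ apply g w)         ∎
  where open ≡-Reasoning

pow-+ : ∀ w k l → pow w (k + l) ≡ pow w k ++ pow w l
pow-+ w zero    l = refl
pow-+ w (suc k) l = trans (cong (w ++_) (pow-+ w k l)) (sym (++-assoc w (pow w k) (pow w l)))

apply-pow : ∀ f w k → apply f (pow w k) ≡ pow (apply f w) k
apply-pow f w zero    = refl
apply-pow f w (suc k) = trans (apply-++ f w (pow w k)) (cong (apply f w ++_) (apply-pow f w k))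

length-pow : ∀ w k → length (pow w k) ≡ k * length w
length-pow w zero    = refl
length-pow w (suc k) = trans (length-++ w) (cong (length w +_) (length-pow w k))

apply-E-involutive : ∀ w → apply E (apply E w) ≡ w
apply-E-involutive []      = refl
apply-E-involutive (a ∷ w) = cong (a ∷_) (apply-E-involutive w)
apply-E-involutive (b ∷ w) = cong (b ∷_) (apply-E-involutive w)

length-apply-E : ∀ w → length (apply E w) ≡ length w
length-apply-E []      = refl
length-apply-E (x ∷ w) = cong suc (length-apply-E w)

nth : {A : Set} → List A → ℕ → Maybe A
nth []      _       = nothing
nth (x ∷ w) zero    = just x
nth (x ∷ w) (suc i) = nth w i

module _ {A : Set} where

  nth-<-length : ∀ (w : List A) i {x} → nth w i ≡ just x → i < length w
  nth-<-length (y ∷ w) zero    _ = s≤s z≤n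
  nth-<-length (y ∷ w) (suc i) e = s≤s (nth-<-length w i e)

  nth-++ : ∀ (u v : List A) i {x} → nth (u ++ v) i ≡ just x
    → nth u i ≡ just x ⊎ Σ ℕ λ r → i ≡ length u + r × nth v r ≡ just x
  nth-++ []      v i       e = inj₂ (i , refl , e)
  nth-++ (y ∷ u) v zero    e = inj₁ e
  nth-++ (y ∷ u) v (suc i) e = Sum.map₂ (λ { (r , i≡ , e′) → r , cong suc i≡ , e′ }) (nth-++ u v i e)

  lookup-from-nth : ∀ (w : List A) (R : ℕ → A → Set) → (∀ i x → nth w i ≡ just x → R i x)
    → ∀ (i : Fin (length w)) → R (toℕ i) (lookup w i)
  lookup-from-nth (x ∷ w) R h Fin.zero    = h 0 x refl
  lookup-from-nth (x ∷ w) R h (Fin.suc i) = lookup-from-nth w (λ k → R (suc k)) (λ k → h (suc k)) i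

nth-pow : ∀ w k i {x} → nth (pow w k) i ≡ just x
  → Σ ℕ λ t → Σ ℕ λ r → i ≡ t * length w + r × t < k × nth w r ≡ just x
nth-pow w (suc k) i e with nth-++ w (pow w k) i e
... | inj₁ e′ = 0 , i , refl , s≤s z≤n , e′
... | inj₂ (r′ , i≡ , e′) with nth-pow w k r′ e′
... | t , r , r′≡ , t<k , e″ =
  suc t , r , trans i≡ (trans (cong (length w +_) r′≡) (sym (+-assoc (length w) _ r))) , s≤s t<k , e″

nth-apply-E : ∀ w i {x} → nth (apply E w) i ≡ just x → Σ Letter λ y → nth w i ≡ just y × x ≡ swap y
nth-apply-E (y ∷ w) zero    refl = y , refl , refl
nth-apply-E (y ∷ w) (suc i) e    = nth-apply-E w i e

second-letter : ∀ {A : Set} {x : A} {w} (v : List A) → v ≡ x ∷ w → 2 ≤ length v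
  → Σ A λ y → Σ (List A) λ w′ → v ≡ x ∷ y ∷ w′
second-letter (x ∷ y ∷ w′) refl _ = y , w′ , refl
second-letter (x ∷ []) refl (s≤s ())

mkℚᵘ-≤ : ∀ u v D D′ → u * suc D′ ≤ v * suc D → mkℚᵘ (ℤ.+ u) D ℚ.≤ mkℚᵘ (ℤ.+ v) D′
mkℚᵘ-≤ u v D D′ h = *≤* (subst₂ ℤ._≤_ (ℤP.pos-* u (suc D′)) (ℤP.pos-* v (suc D)) (+≤+ h))

mkℚᵘ-< : ∀ u v D D′ → u * suc D′ < v * suc D → mkℚᵘ (ℤ.+ u) D ℚ.< mkℚᵘ (ℤ.+ v) D′
mkℚᵘ-< u v D D′ h = *<* (subst₂ ℤ._<_ (ℤP.pos-* u (suc D′)) (ℤP.pos-* v (suc D)) (+<+ h))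

mkℚᵘ-+ : ∀ u v D D′ → mkℚᵘ (ℤ.+ u) D ℚ.+ mkℚᵘ (ℤ.+ v) D′
                     ≡ mkℚᵘ (ℤ.+ (u * suc D′ + v * suc D)) (D′ + D * suc D′)
mkℚᵘ-+ u v D D′ = cong (λ z → mkℚᵘ z (D′ + D * suc D′))
  (trans (cong₂ ℤ._+_ (sym (ℤP.pos-* u (suc D′))) (sym (ℤP.pos-* v (suc D))))
         (sym (ℤP.pos-+ (u * suc D′) (v * suc D))))

ℕ*mkℚᵘ : ∀ j v D → (ℤ.+ j ℚ./ 1) ℚ.* mkℚᵘ (ℤ.+ v) D ≡ mkℚᵘ (ℤ.+ (j * v)) D
ℕ*mkℚᵘ j v D = cong₂ mkℚᵘ (sym (ℤP.pos-* j v)) (+-identityʳ D)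

1-mkℚᵘ : ∀ v D → v ≤ suc D → 1ℚᵘ ℚ.- mkℚᵘ (ℤ.+ v) D ≡ mkℚᵘ (ℤ.+ (suc D ∸ v)) D
1-mkℚᵘ v D v≤ = cong₂ mkℚᵘ numerator (+-identityʳ D)
  where
  numerator : ℤ.+ 1 ℤ.* ℤ.+ suc D ℤ.+ ℤ.- ℤ.+ v ℤ.* ℤ.+ 1 ≡ ℤ.+ (suc D ∸ v)
  numerator = trans (cong₂ ℤ._+_ (ℤP.*-identityˡ (ℤ.+ suc D)) (ℤP.*-identityʳ (ℤ.- ℤ.+ v)))
                    (trans (ℤP.m-n≡m⊖n (suc D) v) (ℤP.⊖-≥ v≤))

-- The hypotheses are G ≤ X k and X k + 1/(M′ + 1) ≤ G + 1 for k ≥ N, with denominators cleared.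
isFloor-fromBounds : (X : RealSeq) (n D : ℕ → ℕ) (G M′ N : ℕ)
  → (∀ k → X k ≡ mkℚᵘ (ℤ.+ n k) (D k))
  → (∀ k → N ≤ k → G * suc (D k) ≤ n k)
  → (∀ k → N ≤ k → suc M′ * n k + suc (D k) ≤ suc M′ * (suc G * suc (D k)))
  → IsFloor X (ℤ.+ G)
isFloor-fromBounds X n D G M′ N X≡ lower upper = G≤X , X<G+1
  where
  G≤X : ¬ (X <ᵣ intR (ℤ.+ G))
  G≤X (ε , ε>0 , N′ , X+ε≤G) = ℚP.<⇒≱ Xk<Xk+ε (ℚP.≤-trans (X+ε≤G k (m≤n⊔m N N′)) G≤Xk)
    where
    k = N ⊔ N′
    Xk<Xk+ε : X k ℚ.< X k ℚ.+ ε
    Xk<Xk+ε = subst (ℚ._< X k ℚ.+ ε) (ℚP.+-identityʳ-≡ (X k)) (ℚP.+-monoʳ-< (X k) ε>0)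
    G≤Xk : intR (ℤ.+ G) k ℚ.≤ X k
    G≤Xk rewrite X≡ k =
      mkℚᵘ-≤ G (n k) 0 (D k) (subst (G * suc (D k) ≤_) (sym (*-identityʳ _)) (lower k (m≤m⊔n N N′)))
  X<G+1 : X <ᵣ intR (ℤ.+ G ℤ.+ ℤ.+ 1)
  X<G+1 = mkℚᵘ (ℤ.+ 1) M′ , mkℚᵘ-< 0 1 0 M′ (s≤s z≤n) , N , bound
    where
    bound : ∀ k → N ≤ k → X k ℚ.+ mkℚᵘ (ℤ.+ 1) M′ ℚ.≤ intR (ℤ.+ G ℤ.+ ℤ.+ 1) k
    bound k N≤k rewrite X≡ k | mkℚᵘ-+ (n k) 1 (D k) M′ =
      mkℚᵘ-≤ _ (G + 1) (M′ + D k * suc M′) 0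
        (subst₂ _≤_ (lhs M′ (n k) (D k)) (rhs M′ G (D k)) (upper k N≤k))
      where
      lhs : ∀ M u v → suc M * u + suc v ≡ (u * suc M + 1 * suc v) * 1
      lhs = solve-∀
      rhs : ∀ M g v → suc M * (suc g * suc v) ≡ (g + 1) * (suc v * suc M)
      rhs = solve-∀

<ᵣ-≤-trans : ∀ {X Y Z} → X <ᵣ Y → (∀ k → Y k ℚ.≤ Z k) → X <ᵣ Z
<ᵣ-≤-trans (ε , ε>0 , N , f) Y≤Z = ε , ε>0 , N , λ k N≤k → ℚP.≤-trans (f k N≤k) (Y≤Z k)

isFloor-≮ : ∀ {X m m′} → IsFloor X m → IsFloor X m′ → ¬ (m ℤ.< m′)
isFloor-≮ {X} {m} {m′} (_ , X<m+1) (m′≤X , _) m<m′ = m′≤X (<ᵣ-≤-trans {X} X<m+1 m+1≤m′)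
  where
  m+1≤m′ : ∀ k → intR (m ℤ.+ ℤ.+ 1) k ℚ.≤ intR m′ k
  m+1≤m′ _ = *≤* (subst₂ ℤ._≤_ (sym (ℤP.*-identityʳ _)) (sym (ℤP.*-identityʳ _))
                  (subst (ℤ._≤ m′) (ℤP.+-comm (ℤ.+ 1) m) (ℤP.i<j⇒suc[i]≤j m<m′)))

isFloor-unique : ∀ {X m m′} → IsFloor X m → IsFloor X m′ → m ≡ m′
isFloor-unique {X} {m} {m′} ⌊X⌋≡m ⌊X⌋≡m′ with ℤP.<-cmp m m′
... | tri≈ _ m≡m′ _ = m≡m′
... | tri< m<m′ _ _ = ⊥-elim (isFloor-≮ {X} ⌊X⌋≡m ⌊X⌋≡m′ m<m′)
... | tri> _ _ m′<m = ⊥-elim (isFloor-≮ {X} ⌊X⌋≡m′ ⌊X⌋≡m m′<m)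

module LinearRecurrence (c : ℕ → ℕ) (c-pos : ∀ k → 1 ≤ c (suc (suc k))) where

  record Recurrent (z : ℕ → ℕ) : Set where
    constructor recurrent
    field recurrence : ∀ k → z (suc (suc k)) ≡ c (suc (suc k)) * z (suc k) + z k

  open Recurrent public

  recurrent-linear : ∀ {x y} A B → Recurrent x → Recurrent y → Recurrent (λ k → A * x k + B * y k)
  recurrent-linear {x} {y} A B rx ry = recurrent λ k → begin
    A * x (suc (suc k)) + B * y (suc (suc k))
      ≡⟨ cong₂ (λ u v → A * u + B * v) (recurrence rx k) (recurrence ry k) ⟩
    A * (c (suc (suc k)) * x (suc k) + x k) + B * (c (suc (suc k)) * y (suc k) + y k)
      ≡⟨ distrib A B (c (suc (suc k))) (x (suc k)) (x k) (y (suc k)) (y k) ⟩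
    c (suc (suc k)) * (A * x (suc k) + B * y (suc k)) + (A * x k + B * y k) ∎
    where
    open ≡-Reasoning
    distrib : ∀ A B C x₁ x₀ y₁ y₀
      → A * (C * x₁ + x₀) + B * (C * y₁ + y₀) ≡ C * (A * x₁ + B * y₁) + (A * x₀ + B * y₀)
    distrib = solve-∀

  recurrent-scale : ∀ {x} A → Recurrent x → Recurrent (λ k → A * x k)
  recurrent-scale {x} A rx = recurrent λ k →
    trans (cong (A *_) (recurrence rx k)) (distrib A (c (suc (suc k))) (x (suc k)) (x k))
    where
    distrib : ∀ A C x₁ x₀ → A * (C * x₁ + x₀) ≡ C * (A * x₁) + A * x₀
    distrib = solve-∀

  recurrent-≥-sum : ∀ {z} → Recurrent z → ∀ k → z (suc k) + z k ≤ z (suc (suc k))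
  recurrent-≥-sum {z} rz k rewrite recurrence rz k =
    +-monoˡ-≤ (z k) (m≤n*m (z (suc k)) (c (suc (suc k))) {{>-nonZero (c-pos k)}})

  recurrent-mono : ∀ {z} → Recurrent z → z 0 ≤ z 1 → ∀ k → z k ≤ z (suc k)
  recurrent-mono rz z₀≤z₁ zero    = z₀≤z₁
  recurrent-mono rz z₀≤z₁ (suc k) = ≤-trans (m≤m+n _ _) (recurrent-≥-sum rz k)

  module _ {x y : ℕ → ℕ} (rx : Recurrent x) (ry : Recurrent y) where

    ≤-propagate : ∀ K → x K ≤ y K → x (suc K) ≤ y (suc K) → ∀ k → K ≤ k → x k ≤ y k
    ≤-propagate K x≤y₀ x≤y₁ k K≤k = subst (λ z → x z ≤ y z) (m∸n+n≡m K≤k) (proj₁ (pair (k ∸ K)))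
      where
      pair : ∀ m → x (m + K) ≤ y (m + K) × x (suc (m + K)) ≤ y (suc (m + K))
      pair zero    = x≤y₀ , x≤y₁
      pair (suc m) with pair m
      ... | x≤y , x≤y′ rewrite recurrence rx (m + K) | recurrence ry (m + K) =
        x≤y′ , +-mono-≤ (*-monoʳ-≤ (c (suc (suc (m + K)))) x≤y′) x≤y

    strict-after-two-steps : ∀ K → x K ≤ y K → x (suc K) ≤ y (suc K)
      → ¬ (x K ≡ y K × x (suc K) ≡ y (suc K))
      → x (suc (suc K)) < y (suc (suc K)) × x (suc (suc (suc K))) < y (suc (suc (suc K)))
    strict-after-two-steps K x≤y₀ x≤y₁ not-both-≡ = x<y₂ , x<y₃
      where
      x<y₂ : x (suc (suc K)) < y (suc (suc K))
      x<y₂ rewrite recurrence rx K | recurrence ry K with x K ≟ y K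
      ... | no x≢y = subst (_≤ c (suc (suc K)) * y (suc K) + y K) (+-suc _ (x K))
                       (+-mono-≤ (*-monoʳ-≤ (c (suc (suc K))) x≤y₁) (≤∧≢⇒< x≤y₀ x≢y))
      ... | yes x≡y = +-mono-≤
        (*-monoʳ-< (c (suc (suc K))) {{>-nonZero (c-pos K)}} (≤∧≢⇒< x≤y₁ (λ e → not-both-≡ (x≡y , e)))) x≤y₀
      x<y₃ : x (suc (suc (suc K))) < y (suc (suc (suc K)))
      x<y₃ rewrite recurrence rx (suc K) | recurrence ry (suc K) =
        +-mono-≤ (*-monoʳ-< (c (suc (suc (suc K)))) {{>-nonZero (c-pos (suc K))}} x<y₂) x≤y₁

  margin-propagate : ∀ {x y z} → Recurrent x → Recurrent y → Recurrent z → ∀ K M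
    → x K < y K → x (suc K) < y (suc K) → z K ≤ M → z (suc K) ≤ M
    → ∀ k → K ≤ k → M * x k + z k ≤ M * y k
  margin-propagate {x} {y} {z} rx ry rz K M x<y₀ x<y₁ z≤M₀ z≤M₁ k K≤k =
    subst (λ w → M * x k + w ≤ M * y k) (*-identityˡ (z k))
      (≤-propagate (recurrent-linear M 1 rx rz) (recurrent-scale M ry) K
        (step x<y₀ z≤M₀) (step x<y₁ z≤M₁) k K≤k)
    where
    step : ∀ {u v w} → u < v → w ≤ M → M * u + 1 * w ≤ M * v
    step {u} {v} {w} u<v w≤M = ≤-trans (+-monoʳ-≤ (M * u) (≤-trans (≤-reflexive (*-identityˡ w)) w≤M))
      (subst (_≤ M * v) (trans (*-suc M u) (+-comm M (M * u))) (*-monoʳ-≤ M u<v))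

data Position : Set where
  below above : Position

opposite : Position → Position
opposite below = above
opposite above = below

-- Det below P Q P′ Q′ says P′/Q′ − P/Q = 1/(Q Q′); Det above, the same with the sign flipped.
Det : Position → (P Q P′ Q′ : ℕ) → Set
Det below P Q P′ Q′ = P′ * Q ≡ P * Q′ + 1
Det above P Q P′ Q′ = P * Q′ ≡ P′ * Q + 1

det-step : ∀ s {P Q P′ Q′} C → Det s P Q P′ Q′ → Det (opposite s) P′ Q′ (C * P′ + P) (C * Q′ + Q)
det-step below {P} {Q} {P′} {Q′} C det = begin
  P′ * (C * Q′ + Q)        ≡⟨ expand C P′ Q′ Q ⟩
  C * P′ * Q′ + P′ * Q     ≡⟨ cong (C * P′ * Q′ +_) det ⟩
  C * P′ * Q′ + (P * Q′ + 1) ≡⟨ collect C P′ Q′ P ⟩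
  (C * P′ + P) * Q′ + 1    ∎
  where
  open ≡-Reasoning
  expand : ∀ C P′ Q′ Q → P′ * (C * Q′ + Q) ≡ C * P′ * Q′ + P′ * Q
  expand = solve-∀
  collect : ∀ C P′ Q′ P → C * P′ * Q′ + (P * Q′ + 1) ≡ (C * P′ + P) * Q′ + 1
  collect = solve-∀
det-step above {P} {Q} {P′} {Q′} C det = begin
  (C * P′ + P) * Q′        ≡⟨ expand C P′ Q′ P ⟩
  C * P′ * Q′ + P * Q′     ≡⟨ cong (C * P′ * Q′ +_) det ⟩
  C * P′ * Q′ + (P′ * Q + 1) ≡⟨ collect C P′ Q′ Q ⟩
  P′ * (C * Q′ + Q) + 1    ∎
  where
  open ≡-Reasoning
  expand : ∀ C P′ Q′ P → (C * P′ + P) * Q′ ≡ C * P′ * Q′ + P * Q′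
  expand = solve-∀
  collect : ∀ C P′ Q′ Q → C * P′ * Q′ + (P′ * Q + 1) ≡ P′ * (C * Q′ + Q) + 1
  collect = solve-∀

farey-bound : ∀ j A B Q Q′ u v → (suc B + v) * Q ≡ A * Q′ + j → B * Q ≡ (suc A + u) * Q′
  → Q + Q′ ≤ j
farey-bound j A B Q Q′ u v e₁ e₂ =
  subst (Q + Q′ ≤_) j≡ (≤-trans (m≤m+n (Q + Q′) (u * Q′)) (m≤m+n _ (v * Q)))
  where
  expand₁ : ∀ B v Q → (suc B + v) * Q ≡ Q + B * Q + v * Q
  expand₁ = solve-∀
  expand₂ : ∀ A Q Q′ u v → Q + (suc A + u) * Q′ + v * Q ≡ A * Q′ + (Q + Q′ + u * Q′ + v * Q)
  expand₂ = solve-∀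
  j≡ : Q + Q′ + u * Q′ + v * Q ≡ j
  j≡ = +-cancelˡ-≡ (A * Q′) _ _ (begin
    A * Q′ + (Q + Q′ + u * Q′ + v * Q) ≡⟨ expand₂ A Q Q′ u v ⟨
    Q + (suc A + u) * Q′ + v * Q       ≡⟨ cong (λ z → Q + z + v * Q) e₂ ⟨
    Q + B * Q + v * Q                  ≡⟨ expand₁ B v Q ⟨
    (suc B + v) * Q                    ≡⟨ e₁ ⟩
    A * Q′ + j                         ∎)
    where open ≡-Reasoning

-- g is the candidate for ⌊jα⌋ read off from an approximation P/Q of α lying on the given side of α:
-- from above, jP = (g + 1)Q is still compatible with jα < g + 1.
FloorAt : Position → (j P Q g : ℕ) → Set
FloorAt below j P Q g = g * Q ≤ j * P × j * P < suc g * Q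
FloorAt above j P Q g = g * Q < j * P × j * P ≤ suc g * Q

floorAt-bounds : ∀ s {j P Q g} → FloorAt s j P Q g → g * Q ≤ j * P × j * P ≤ suc g * Q
floorAt-bounds below (lo , hi) = lo , <⇒≤ hi
floorAt-bounds above (lo , hi) = <⇒≤ lo , hi

private
  mul-assoc-comm : ∀ j P Q → j * (P * Q) ≡ j * P * Q
  mul-assoc-comm = solve-∀
  mul-+1 : ∀ j P Q → j * (P * Q + 1) ≡ j * P * Q + j
  mul-+1 = solve-∀
  mul-swap : ∀ g Q Q′ → g * Q′ * Q ≡ g * Q * Q′
  mul-swap = solve-∀

-- If a bound failed at P′/Q′, an integer would separate j P/Q from its Farey neighbour j P′/Q′,
-- forcing j ≥ Q + Q′.
floorAt-neighbour : ∀ s {j P Q P′ Q′ g} → Det s P Q P′ Q′ → 1 ≤ Q → FloorAt s j P Q g → j < Q + Q′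
  → g * Q′ ≤ j * P′ × j * P′ ≤ suc g * Q′
floorAt-neighbour below {j} {P} {Q} {P′} {Q′} {g} det Q≥1 (lo , hi) j<Q+Q′ = lo′ , hi′
  where
  instance _ = >-nonZero Q≥1
  lo′ : g * Q′ ≤ j * P′
  lo′ = *-cancelʳ-≤ (g * Q′) (j * P′) Q (begin
    g * Q′ * Q       ≡⟨ mul-swap g Q Q′ ⟩
    g * Q * Q′       ≤⟨ *-monoˡ-≤ Q′ lo ⟩
    j * P * Q′       ≤⟨ m≤m+n _ j ⟩
    j * P * Q′ + j   ≡⟨ mul-+1 j P Q′ ⟨
    j * (P * Q′ + 1) ≡⟨ cong (j *_) det ⟨
    j * (P′ * Q)     ≡⟨ mul-assoc-comm j P′ Q ⟩
    j * P′ * Q       ∎)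
    where open ≤-Reasoning
  hi′ : j * P′ ≤ suc g * Q′
  hi′ with j * P′ ≤? suc g * Q′
  ... | yes ≤hi = ≤hi
  ... | no ≰hi = ⊥-elim (<⇒≱ j<Q+Q′ (farey-bound j (j * P) (suc g * Q′) Q Q′ u v e₁ e₂))
    where
    u = proj₁ (m≤n⇒∃[o]m+o≡n hi)
    v = proj₁ (m≤n⇒∃[o]m+o≡n (≰⇒> ≰hi))
    e₁ : (suc (suc g * Q′) + v) * Q ≡ j * P * Q′ + j
    e₁ = trans (cong (_* Q) (proj₂ (m≤n⇒∃[o]m+o≡n (≰⇒> ≰hi))))
           (trans (sym (mul-assoc-comm j P′ Q)) (trans (cong (j *_) det) (mul-+1 j P Q′)))
    e₂ : suc g * Q′ * Q ≡ (suc (j * P) + u) * Q′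
    e₂ = trans (mul-swap (suc g) Q Q′) (cong (_* Q′) (sym (proj₂ (m≤n⇒∃[o]m+o≡n hi))))
floorAt-neighbour above {j} {P} {Q} {P′} {Q′} {g} det Q≥1 (lo , hi) j<Q+Q′ = lo′ , hi′
  where
  instance _ = >-nonZero Q≥1
  hi′ : j * P′ ≤ suc g * Q′
  hi′ = *-cancelʳ-≤ (j * P′) (suc g * Q′) Q (begin
    j * P′ * Q       ≤⟨ m≤m+n _ j ⟩
    j * P′ * Q + j   ≡⟨ mul-+1 j P′ Q ⟨
    j * (P′ * Q + 1) ≡⟨ cong (j *_) det ⟨
    j * (P * Q′)     ≡⟨ mul-assoc-comm j P Q′ ⟩
    j * P * Q′       ≤⟨ *-monoˡ-≤ Q′ hi ⟩
    suc g * Q * Q′   ≡⟨ mul-swap (suc g) Q Q′ ⟨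
    suc g * Q′ * Q   ∎)
    where open ≤-Reasoning
  lo′ : g * Q′ ≤ j * P′
  lo′ with g * Q′ ≤? j * P′
  ... | yes ≤lo = ≤lo
  ... | no ≰lo =
    ⊥-elim (<⇒≱ j<Q+Q′ (subst (_≤ j) (+-comm Q′ Q) (farey-bound j (j * P′) (g * Q) Q′ Q v u e₁ e₂)))
    where
    u = proj₁ (m≤n⇒∃[o]m+o≡n lo)
    v = proj₁ (m≤n⇒∃[o]m+o≡n (≰⇒> ≰lo))
    e₁ : (suc (g * Q) + u) * Q′ ≡ j * P′ * Q + j
    e₁ = trans (cong (_* Q′) (proj₂ (m≤n⇒∃[o]m+o≡n lo)))
           (trans (sym (mul-assoc-comm j P Q′)) (trans (cong (j *_) det) (mul-+1 j P′ Q)))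
    e₂ : g * Q * Q′ ≡ (suc (j * P′) + v) * Q
    e₂ = trans (sym (mul-swap g Q Q′)) (cong (_* Q) (sym (proj₂ (m≤n⇒∃[o]m+o≡n (≰⇒> ≰lo)))))

det-separates : ∀ s {P Q P′ Q′} A B → Det s P Q P′ Q′ → 1 ≤ B
  → ¬ (A * Q ≡ B * P × A * Q′ ≡ B * P′)
det-separates below {P} {Q} {P′} {Q′} A B det B≥1 (e , e′) =
  <⇒≢ B≥1 (+-cancelˡ-≡ _ 0 B (trans (+-identityʳ _) (begin
    A * Q * Q′       ≡⟨ mul-swap A Q Q′ ⟨
    A * Q′ * Q       ≡⟨ cong (_* Q) e′ ⟩
    B * P′ * Q       ≡⟨ mul-assoc-comm B P′ Q ⟨
    B * (P′ * Q)     ≡⟨ cong (B *_) det ⟩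
    B * (P * Q′ + 1) ≡⟨ mul-+1 B P Q′ ⟩
    B * P * Q′ + B   ≡⟨ cong (λ z → z * Q′ + B) e ⟨
    A * Q * Q′ + B   ∎)))
  where open ≡-Reasoning
det-separates above {P} {Q} {P′} {Q′} A B det B≥1 (e , e′) =
  <⇒≢ B≥1 (+-cancelˡ-≡ _ 0 B (trans (+-identityʳ _) (begin
    A * Q′ * Q       ≡⟨ mul-swap A Q Q′ ⟩
    A * Q * Q′       ≡⟨ cong (_* Q′) e ⟩
    B * P * Q′       ≡⟨ mul-assoc-comm B P Q′ ⟨
    B * (P * Q′)     ≡⟨ cong (B *_) det ⟩
    B * (P′ * Q + 1) ≡⟨ mul-+1 B P′ Q ⟩
    B * P′ * Q + B   ≡⟨ cong (λ z → z * Q + B) e′ ⟨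
    A * Q′ * Q + B   ∎)))
  where open ≡-Reasoning

division-bounds : ∀ m D → (m / suc D) * suc D ≤ m × m < suc (m / suc D) * suc D
division-bounds m D = lower , upper
  where
  m≡ : m ≡ m % suc D + (m / suc D) * suc D
  m≡ = m≡m%n+[m/n]*n m (suc D)
  lower : (m / suc D) * suc D ≤ m
  lower = subst ((m / suc D) * suc D ≤_) (sym m≡) (m≤n+m _ _)
  upper : m < suc (m / suc D) * suc D
  upper = subst (_< suc (m / suc D) * suc D) (sym m≡) (+-monoˡ-< _ (m%n<n m (suc D)))

floorAt-exists : ∀ s j P Q → 1 ≤ Q → (s ≡ above → 1 ≤ j * P) → Σ ℕ (FloorAt s j P Q)
floorAt-exists below j P (suc D) _ _ = j * P / suc D , division-bounds (j * P) D
floorAt-exists above j P (suc D) _ jP≥1 with division-bounds (j * P ∸ 1) D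
... | lower , upper = g , subst (g * suc D <_) jP≡ (s≤s lower) , subst (_≤ suc g * suc D) jP≡ upper
  where
  g = (j * P ∸ 1) / suc D
  jP≡ : suc (j * P ∸ 1) ≡ j * P
  jP≡ = m+[n∸m]≡n (jP≥1 refl)

floorAt-shift : ∀ s {j P Q g} t → FloorAt s j P Q g → FloorAt s (t * Q + j) P Q (t * P + g)
floorAt-shift s {j} {P} {Q} {g} t = shift s
  where
  lhs : ∀ t P Q g → (t * P + g) * Q ≡ t * P * Q + g * Q
  lhs = solve-∀
  mid : ∀ t P Q j → (t * Q + j) * P ≡ t * P * Q + j * P
  mid = solve-∀
  rhs : ∀ t P Q g → suc (t * P + g) * Q ≡ t * P * Q + suc g * Q
  rhs = solve-∀
  shift-≤ : ∀ {x y} → x ≤ y → t * P * Q + x ≤ t * P * Q + y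
  shift-≤ = +-monoʳ-≤ (t * P * Q)
  shift-< : ∀ {x y} → x < y → t * P * Q + x < t * P * Q + y
  shift-< {x} {y} x<y = subst (_≤ t * P * Q + y) (+-suc _ x) (shift-≤ x<y)
  shift : ∀ s → FloorAt s j P Q g → FloorAt s (t * Q + j) P Q (t * P + g)
  shift below (lo , hi) = subst₂ _≤_ (sym (lhs t P Q g)) (sym (mid t P Q j)) (shift-≤ lo)
                        , subst₂ _<_ (sym (mid t P Q j)) (sym (rhs t P Q g)) (shift-< hi)
  shift above (lo , hi) = subst₂ _<_ (sym (lhs t P Q g)) (sym (mid t P Q j)) (shift-< lo)
                        , subst₂ _≤_ (sym (mid t P Q j)) (sym (rhs t P Q g)) (shift-≤ hi)

complement-bounds : ∀ j g h M′ Q P → h + suc g ≡ j → P ≤ Q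
  → suc M′ * (g * Q) + Q ≤ suc M′ * (j * P) → suc M′ * (j * P) + Q ≤ suc M′ * (suc g * Q)
  → h * Q ≤ j * (Q ∸ P) × suc M′ * (j * (Q ∸ P)) + Q ≤ suc M′ * (suc h * Q)
complement-bounds j g h M′ Q P h+g+1≡j P≤Q lower upper = lower′ , upper′
  where
  M = suc M′
  Z = j * (Q ∸ P)
  Z+jP≡jQ : Z + j * P ≡ j * Q
  Z+jP≡jQ = trans (sym (*-distribˡ-+ j (Q ∸ P) P)) (cong (j *_) (m∸n+n≡m P≤Q))
  jQ≡ : j * Q ≡ (h + suc g) * Q
  jQ≡ = cong (_* Q) (sym h+g+1≡j)
  lower′ : h * Q ≤ Z
  lower′ = +-cancelʳ-≤ (j * P) (h * Q) Z (begin
    h * Q + j * P         ≤⟨ +-monoʳ-≤ (h * Q) (*-cancelˡ-≤ M (≤-trans (m≤m+n _ Q) upper)) ⟩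
    h * Q + suc g * Q     ≡⟨ *-distribʳ-+ Q h (suc g) ⟨
    (h + suc g) * Q       ≡⟨ jQ≡ ⟨
    j * Q                 ≡⟨ Z+jP≡jQ ⟨
    Z + j * P             ∎)
    where open ≤-Reasoning
  upper′ : M * Z + Q ≤ M * (suc h * Q)
  upper′ = +-cancelʳ-≤ (M * (g * Q)) _ _ (begin
    M * Z + Q + M * (g * Q)      ≡⟨ rearrange M Z Q (g * Q) ⟩
    M * Z + (M * (g * Q) + Q)    ≤⟨ +-monoʳ-≤ (M * Z) lower ⟩
    M * Z + M * (j * P)          ≡⟨ *-distribˡ-+ M Z (j * P) ⟨
    M * (Z + j * P)              ≡⟨ cong (M *_) (trans Z+jP≡jQ jQ≡) ⟩
    M * ((h + suc g) * Q)        ≡⟨ distrib M h g Q ⟩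
    M * (suc h * Q) + M * (g * Q) ∎)
    where
    open ≤-Reasoning
    rearrange : ∀ M Z Q gQ → M * Z + Q + M * gQ ≡ M * Z + (M * gQ + Q)
    rearrange = solve-∀
    distrib : ∀ M h g Q → M * ((h + suc g) * Q) ≡ M * (suc h * Q) + M * (g * Q)
    distrib = solve-∀

module Convergents (d : ℕ → ℕ) (d-pos : ∀ k → 1 ≤ k → 1 ≤ d k) where

  p q : ℕ → ℕ
  p k = P d (suc k)
  q k = Qd d (suc k)

  open LinearRecurrence (pq d) (λ k → d-pos (suc (suc k)) (s≤s z≤n)) public

  recurrent-p : Recurrent p
  recurrent-p = recurrent λ k → refl

  recurrent-q : Recurrent q
  recurrent-q = recurrent λ k → refl

  p₁≡1 : p 1 ≡ 1
  p₁≡1 = cong (_+ 1) (*-zeroʳ (d 1))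

  q₁≡1+d₁ : q 1 ≡ suc (d 1)
  q₁≡1+d₁ = trans (+-identityʳ _) (cong suc (*-identityʳ (d 1)))

  q-mono : ∀ k → q k ≤ q (suc k)
  q-mono = recurrent-mono recurrent-q (subst (1 ≤_) (sym q₁≡1+d₁) (s≤s z≤n))

  q-pos : ∀ k → 1 ≤ q k
  q-pos zero    = s≤s z≤n
  q-pos (suc k) = ≤-trans (q-pos k) (q-mono k)

  q≥2 : ∀ k → 2 ≤ q (suc k)
  q≥2 zero    = subst (2 ≤_) (sym q₁≡1+d₁) (s≤s (d-pos 1 (s≤s z≤n)))
  q≥2 (suc k) = ≤-trans (q≥2 k) (q-mono (suc k))

  q>k : ∀ k → k < q k
  q>k zero    = s≤s z≤n
  q>k (suc k) = ≤-trans (s≤s (q>k k)) (q<q k)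
    where
    q<q : ∀ k → q k < q (suc k)
    q<q zero    = subst (1 <_) (sym q₁≡1+d₁) (s≤s (d-pos 1 (s≤s z≤n)))
    q<q (suc k) = ≤-trans (subst (_≤ q (suc k) + q k) (+-comm (q (suc k)) 1) (+-monoʳ-≤ (q (suc k)) (q-pos k)))
                          (recurrent-≥-sum recurrent-q k)

  p-pos : ∀ k → 1 ≤ p (suc k)
  p-pos zero    = subst (1 ≤_) (sym p₁≡1) ≤-refl
  p-pos (suc k) = ≤-trans (p-pos k) (recurrent-mono recurrent-p z≤n (suc k))

  p≤q : ∀ k → p k ≤ q k
  p≤q k =
    ≤-propagate recurrent-p recurrent-q 0 z≤n (subst₂ _≤_ (sym p₁≡1) (sym q₁≡1+d₁) (s≤s z≤n)) k z≤n

  position : ℕ → Position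
  position zero    = below
  position (suc k) = opposite (position k)

  convergent-det : ∀ k → Det (position k) (p k) (q k) (p (suc k)) (q (suc k))
  convergent-det zero    rewrite *-zeroʳ (d 1) = refl
  convergent-det (suc k) = det-step (position k) (pq d (suc (suc k))) (convergent-det k)

  -- Eventually g + 1/M ≤ j p_k/q_k ≤ g + 1 − 1/M (with M = M′ + 1), which certifies ⌊jα⌋ = g.
  record FloorCert (j g : ℕ) : Set where
    constructor floorCert
    field
      M′ N : ℕ
      bounds : ∀ k → N ≤ k →
        suc M′ * (g * q k) + q k ≤ suc M′ * (j * p k) × suc M′ * (j * p k) + q k ≤ suc M′ * (suc g * q k)

  -- The neighbouring convergent keeps the bounds, Det rules out equality at both, and then the
  -- bounds become strict two steps later and persist with margin 1/M, M = q_{K+2} + q_{K+3} + 1.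
  floorCert-fromFloorAt : ∀ K {j g} → FloorAt (position K) j (p K) (q K) g → 1 ≤ j → j < q K + q (suc K)
    → FloorCert j g
  floorCert-fromFloorAt K {j} {g} floorAt j≥1 j< = floorCert M′ K₂ λ k K₂≤k →
      margin-propagate (recurrent-scale g recurrent-q) (recurrent-scale j recurrent-p) recurrent-q
        K₂ (suc M′) (proj₁ lo-strict) (proj₂ lo-strict) q≤M₂ q≤M₃ k K₂≤k
    , margin-propagate (recurrent-scale j recurrent-p) (recurrent-scale (suc g) recurrent-q) recurrent-q
        K₂ (suc M′) (proj₁ hi-strict) (proj₂ hi-strict) q≤M₂ q≤M₃ k K₂≤k
    where
    K₂ K₃ M′ : ℕ
    K₂ = suc (suc K)
    K₃ = suc K₂
    M′ = q K₂ + q K₃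
    det : Det (position K) (p K) (q K) (p (suc K)) (q (suc K))
    det = convergent-det K
    bounds₀ : g * q K ≤ j * p K × j * p K ≤ suc g * q K
    bounds₀ = floorAt-bounds (position K) floorAt
    bounds₁ : g * q (suc K) ≤ j * p (suc K) × j * p (suc K) ≤ suc g * q (suc K)
    bounds₁ = floorAt-neighbour (position K) det (q-pos K) floorAt j<
    lo-strict : g * q K₂ < j * p K₂ × g * q K₃ < j * p K₃
    lo-strict = strict-after-two-steps (recurrent-scale g recurrent-q) (recurrent-scale j recurrent-p) K
      (proj₁ bounds₀) (proj₁ bounds₁) (det-separates (position K) g j det j≥1)
    hi-strict : j * p K₂ < suc g * q K₂ × j * p K₃ < suc g * q K₃
    hi-strict = strict-after-two-steps (recurrent-scale j recurrent-p) (recurrent-scale (suc g) recurrent-q) K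
      (proj₂ bounds₀) (proj₂ bounds₁)
      (λ (e , e′) → det-separates (position K) (suc g) j det j≥1 (sym e , sym e′))
    q≤M₂ : q K₂ ≤ suc M′
    q≤M₂ = ≤-trans (m≤m+n _ _) (n≤1+n _)
    q≤M₃ : q K₃ ≤ suc M′
    q≤M₃ = ≤-trans (m≤n+m _ (q K₂)) (n≤1+n _)

  private
    <-from-margin : ∀ M {x y} Q → 1 ≤ Q → M * x + Q ≤ M * y → x < y
    <-from-margin M {x} {y} Q Q≥1 h =
      *-cancelˡ-< M x y (<-≤-trans (subst (_< M * x + Q) (+-identityʳ _) (+-monoʳ-< (M * x) Q≥1)) h)

  floorCert-≤ : ∀ {j g g′} → FloorCert j g → FloorCert j g′ → g ≤ g′
  floorCert-≤ {j} {g} {g′} (floorCert M N cert) (floorCert M′ N′ cert′) =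
    s≤s⁻¹ (*-cancelʳ-< (q k) g (suc g′) (<-trans gq<jp jp<g′q))
    where
    k = N ⊔ N′
    gq<jp : g * q k < j * p k
    gq<jp = <-from-margin (suc M) (q k) (q-pos k) (proj₁ (cert k (m≤m⊔n N N′)))
    jp<g′q : j * p k < suc g′ * q k
    jp<g′q = <-from-margin (suc M′) (q k) (q-pos k) (proj₂ (cert′ k (m≤n⊔m N N′)))

  floorCert-unique : ∀ {j g g′} → FloorCert j g → FloorCert j g′ → g ≡ g′
  floorCert-unique c c′ = ≤-antisym (floorCert-≤ c c′) (floorCert-≤ c′ c)

  floorCert-< : ∀ {j g} → FloorCert j g → g < j
  floorCert-< {j} {g} (floorCert M N cert) = *-cancelʳ-< (q N) g j
    (<-≤-trans (<-from-margin (suc M) (q N) (q-pos N) (proj₁ (cert N ≤-refl))) (*-monoʳ-≤ j (p≤q N)))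

  p-pos-above : ∀ k → position k ≡ above → 1 ≤ p k
  p-pos-above (suc k) _ = p-pos k

  floorCert-shift : ∀ K t {j g} → 1 ≤ j → t * q K + j < q K + q (suc K) → FloorCert j g
    → FloorCert (t * q K + j) (t * p K + g)
  floorCert-shift K t {j} {g} j≥1 j′< cert
    with floorAt-exists (position K) j (p K) (q K) (q-pos K) (λ e → *-mono-≤ j≥1 (p-pos-above K e))
  ... | h , floorAt
    rewrite floorCert-unique cert (floorCert-fromFloorAt K floorAt j≥1 (≤-<-trans (m≤n+m j _) j′<)) =
    floorCert-fromFloorAt K (floorAt-shift (position K) t floorAt) (≤-trans j≥1 (m≤n+m j _)) j′<

  data CharLetterCert (i : ℕ) : Letter → Set where
    flat : ∀ {g} → FloorCert (suc i) g → FloorCert (suc (suc i)) g → CharLetterCert i a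
    step : ∀ {g} → FloorCert (suc i) g → FloorCert (suc (suc i)) (suc g) → CharLetterCert i b

  private
    floorCert-shift-suc : ∀ K t {r g} → suc (t * q K + r) < q K + q (suc K) → FloorCert (suc r) g
      → FloorCert (suc (t * q K + r)) (t * p K + g)
    floorCert-shift-suc K t {r} {g} bound cert =
      subst (λ j → FloorCert j (t * p K + g)) (+-suc (t * q K) r)
        (floorCert-shift K t (s≤s z≤n) (subst (_< q K + q (suc K)) (sym (+-suc (t * q K) r)) bound) cert)

    floorCert-shift-suc² : ∀ K t {r g} → suc (suc (t * q K + r)) < q K + q (suc K) → FloorCert (suc (suc r)) g
      → FloorCert (suc (suc (t * q K + r))) (t * p K + g)
    floorCert-shift-suc² K t {r} {g} bound cert =
      subst (λ j → FloorCert (suc j) (t * p K + g)) (+-suc (t * q K) r)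
        (floorCert-shift-suc K t (subst (λ j → suc j < q K + q (suc K)) (sym (+-suc (t * q K) r)) bound) cert)

  charLetterCert-shift : ∀ K t {r ℓ} → suc (suc (t * q K + r)) < q K + q (suc K)
    → CharLetterCert r ℓ → CharLetterCert (t * q K + r) ℓ
  charLetterCert-shift K t bound (flat c₁ c₂) =
    flat (floorCert-shift-suc K t (<-trans (n<1+n _) bound) c₁) (floorCert-shift-suc² K t bound c₂)
  charLetterCert-shift K t bound (step {g} c₁ c₂) =
    step (floorCert-shift-suc K t (<-trans (n<1+n _) bound) c₁)
         (subst (FloorCert _) (+-suc (t * p K) g) (floorCert-shift-suc² K t bound c₂))

  length-S : ∀ k → length (S d (suc k)) ≡ q k
  length-S zero          = refl
  length-S (suc zero)    = begin
    length (pow (a ∷ []) (d 1) ++ b ∷ []) ≡⟨ length-++ (pow (a ∷ []) (d 1)) ⟩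
    length (pow (a ∷ []) (d 1)) + 1
      ≡⟨ cong (_+ 1) (trans (length-pow (a ∷ []) (d 1)) (*-identityʳ (d 1))) ⟩
    d 1 + 1                              ≡⟨ +-comm (d 1) 1 ⟩
    suc (d 1)                            ≡⟨ q₁≡1+d₁ ⟨
    q 1                                  ∎
    where open ≡-Reasoning
  length-S (suc (suc k)) = begin
    length (pow s′ (d (suc (suc k))) ++ S d (suc k))
      ≡⟨ length-++ (pow s′ (d (suc (suc k)))) {S d (suc k)} ⟩
    length (pow s′ (d (suc (suc k)))) + length (S d (suc k))
      ≡⟨ cong (_+ length (S d (suc k))) (length-pow s′ (d (suc (suc k)))) ⟩
    d (suc (suc k)) * length s′ + length (S d (suc k))
      ≡⟨ cong₂ (λ x y → d (suc (suc k)) * x + y) (length-S (suc k)) (length-S k) ⟩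
    q (suc (suc k))
      ∎
    where
    open ≡-Reasoning
    s′ = S d (suc (suc k))

  nth-S-decompose : ∀ K i {ℓ} → nth (S d (suc (suc K))) i ≡ just ℓ
    → Σ ℕ λ t → Σ ℕ λ r → i ≡ t * q K + r
      × (t < d (suc K) × nth (S d (suc K)) r ≡ just ℓ ⊎ t ≡ d (suc K) × nth (S d K) r ≡ just ℓ)
  nth-S-decompose K i e with nth-++ (pow (S d (suc K)) (d (suc K))) (S d K) i e
  ... | inj₁ e′ with nth-pow (S d (suc K)) (d (suc K)) i e′
  ...   | t , r , i≡ , t<d , e″ = t , r , trans i≡ (cong (λ z → t * z + r) (length-S K)) , inj₁ (t<d , e″)
  nth-S-decompose K i e | inj₂ (r , i≡ , e′) =
    d (suc K) , r ,
    trans i≡ (cong (_+ r) (trans (length-pow (S d (suc K)) (d (suc K))) (cong (d (suc K) *_) (length-S K))))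
    , inj₂ (refl , e′)

  Certified : Word → Set
  Certified w = ∀ i ℓ → nth w i ≡ just ℓ → CharLetterCert i ℓ

  private
    charLetterCert-at : ∀ K t r {i ℓ} → suc (suc i) < q K + q (suc K) → i ≡ t * q K + r
      → CharLetterCert r ℓ → CharLetterCert i ℓ
    charLetterCert-at K t r {ℓ = ℓ} bound i≡ cert = subst (λ z → CharLetterCert z ℓ) (sym i≡)
      (charLetterCert-shift K t (subst (λ z → suc (suc z) < q K + q (suc K)) i≡ bound) cert)

    nth-S-bound : ∀ K i {ℓ} → nth (S d (suc (suc (suc K)))) i ≡ just ℓ
      → suc (suc i) < q (suc K) + q (suc (suc K))
    nth-S-bound K i e =
      +-mono-≤ (q≥2 K) (subst (i <_) (length-S (suc (suc K))) (nth-<-length (S d (suc (suc (suc K)))) i e))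

  certified-s₀ : Certified (S d 1)
  certified-s₀ zero .a refl = flat
    (floorCert-fromFloorAt 0 {1} {0} (z≤n , s≤s z≤n) (s≤s z≤n) (s≤s (s≤s z≤n)))
    (floorCert-fromFloorAt 0 {2} {0} (z≤n , s≤s z≤n) (s≤s z≤n) (s≤s (q≥2 0)))

  -- c_α(d₁) = b: the convergent 1/(1 + d₁) already determines ⌊(d₁ + 1)α⌋ = 0 and ⌊(d₁ + 2)α⌋ = 1.
  charLetterCert-d₁ : CharLetterCert (d 1) b
  charLetterCert-d₁ = step {g = 0}
    (floorCert-fromFloorAt 1 (floorAt₁ p₁≡1 q₁≡1+d₁ .proj₁) (s≤s z≤n) (j< (n≤1+n _)))
    (floorCert-fromFloorAt 1 (floorAt₁ p₁≡1 q₁≡1+d₁ .proj₂) (s≤s z≤n) (j< ≤-refl))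
    where
    floorAt₁ : ∀ {P Q} → P ≡ 1 → Q ≡ suc (d 1)
      → FloorAt above (suc (d 1)) P Q 0 × FloorAt above (suc (suc (d 1))) P Q 1
    floorAt₁ refl refl = ( subst (1 ≤_) (sym (*-identityʳ (suc (d 1)))) (s≤s z≤n)
                         , subst₂ _≤_ (sym (*-identityʳ (suc (d 1)))) (sym (*-identityˡ (suc (d 1)))) ≤-refl )
                       , ( subst₂ _≤_ (cong suc (sym (*-identityˡ (suc (d 1)))))
                                      (sym (*-identityʳ (suc (suc (d 1))))) ≤-refl
                         , subst (_≤ 2 * suc (d 1)) (sym (*-identityʳ (suc (suc (d 1)))))
                             (s≤s (≤-trans (s≤s (m≤m+n (d 1) 0)) (m≤n+m _ (d 1)))) )
    j< : ∀ {j} → j ≤ suc (suc (d 1)) → j < q 1 + q 2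
    j< {j} j≤ = ≤-trans (s≤s j≤) (subst (λ z → suc (suc (suc (d 1))) ≤ z + q 2) (sym q₁≡1+d₁)
      (subst (_≤ suc (d 1) + q 2) (+-comm (suc (d 1)) 2) (+-monoʳ-≤ (suc (d 1)) (q≥2 1))))

  certified-s₁ : Certified (S d 2)
  certified-s₁ i ℓ e with nth-S-decompose 0 i e
  ... | t , zero , i≡ , inj₁ (t<d₁ , e′) = charLetterCert-at 0 t 0 bound i≡ (certified-s₀ 0 ℓ e′)
    where
    bound : suc (suc i) < 1 + q 1
    bound rewrite i≡ | q₁≡1+d₁ | +-identityʳ (t * 1) | *-identityʳ t = s≤s (s≤s t<d₁)
  ... | t , zero , i≡ , inj₂ (refl , refl) =
    subst (λ z → CharLetterCert z b) (sym (trans i≡ (trans (+-identityʳ (d 1 * 1)) (*-identityʳ (d 1)))))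
      charLetterCert-d₁

  certified-step : ∀ K → Certified (S d (suc K)) → Certified (S d (suc (suc K)))
    → Certified (S d (suc (suc (suc K))))
  certified-step K cert cert′ i ℓ e with nth-S-decompose (suc K) i e
  ... | t , r , i≡ , inj₁ (_ , e′) = charLetterCert-at (suc K) t r (nth-S-bound K i e) i≡ (cert′ r ℓ e′)
  ... | t , r , i≡ , inj₂ (_ , e′) = charLetterCert-at (suc K) t r (nth-S-bound K i e) i≡ (cert r ℓ e′)

  certified-S : ∀ K → Certified (S d (suc K))
  certified-S K = proj₁ (pair K)
    where
    pair : ∀ K → Certified (S d (suc K)) × Certified (S d (suc (suc K)))
    pair zero    = certified-s₀ , certified-s₁
    pair (suc K) = proj₂ (pair K) , certified-step K (proj₁ (pair K)) (proj₂ (pair K))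

  α : RealSeq
  α = cfValue d

  suc[q∸1]≡q : ∀ k → suc (q k ∸ 1) ≡ q k
  suc[q∸1]≡q k = m+[n∸m]≡n (q-pos k)

  floorCert⇒isFloor : ∀ {j g} → FloorCert j g → IsFloor (j ·ᵣ α) (ℤ.+ g)
  floorCert⇒isFloor {j} {g} (floorCert M′ N bounds) =
    isFloor-fromBounds (j ·ᵣ α) (λ k → j * p k) (λ k → q k ∸ 1) g M′ N
      (λ k → ℕ*mkℚᵘ j (p k) (q k ∸ 1)) lower upper
    where
    lower : ∀ k → N ≤ k → g * suc (q k ∸ 1) ≤ j * p k
    lower k N≤k = subst (λ z → g * z ≤ j * p k) (sym (suc[q∸1]≡q k))
      (*-cancelˡ-≤ (suc M′) (≤-trans (m≤m+n _ (q k)) (proj₁ (bounds k N≤k))))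
    upper : ∀ k → N ≤ k → suc M′ * (j * p k) + suc (q k ∸ 1) ≤ suc M′ * (suc g * suc (q k ∸ 1))
    upper k N≤k =
      subst (λ z → suc M′ * (j * p k) + z ≤ suc M′ * (suc g * z)) (sym (suc[q∸1]≡q k)) (proj₂ (bounds k N≤k))

  floorCert⇒isFloor-oneMinus : ∀ {j g h} → FloorCert j g → h + suc g ≡ j
    → IsFloor (j ·ᵣ oneMinus α) (ℤ.+ h)
  floorCert⇒isFloor-oneMinus {j} {g} {h} (floorCert M′ N bounds) h+g+1≡j =
    isFloor-fromBounds (j ·ᵣ oneMinus α) (λ k → j * (suc (q k ∸ 1) ∸ p k)) (λ k → q k ∸ 1) h M′ N value
      (λ k N≤k → proj₁ (complement k N≤k)) (λ k N≤k → proj₂ (complement k N≤k))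
    where
    p≤q′ : ∀ k → p k ≤ suc (q k ∸ 1)
    p≤q′ k = subst (p k ≤_) (sym (suc[q∸1]≡q k)) (p≤q k)
    value : ∀ k → (j ·ᵣ oneMinus α) k ≡ mkℚᵘ (ℤ.+ (j * (suc (q k ∸ 1) ∸ p k))) (q k ∸ 1)
    value k = trans (cong ((ℤ.+ j ℚ./ 1) ℚ.*_) (1-mkℚᵘ (p k) (q k ∸ 1) (p≤q′ k))) (ℕ*mkℚᵘ j _ (q k ∸ 1))
    complement : ∀ k → N ≤ k → h * suc (q k ∸ 1) ≤ j * (suc (q k ∸ 1) ∸ p k)
      × suc M′ * (j * (suc (q k ∸ 1) ∸ p k)) + suc (q k ∸ 1) ≤ suc M′ * (suc h * suc (q k ∸ 1))
    complement k N≤k = complement-bounds j g h M′ (suc (q k ∸ 1)) (p k) h+g+1≡j (p≤q′ k)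
      (subst (λ z → suc M′ * (g * z) + z ≤ suc M′ * (j * p k)) (sym (suc[q∸1]≡q k)) (proj₁ (bounds k N≤k)))
      (subst (λ z → suc M′ * (j * p k) + z ≤ suc M′ * (suc g * z)) (sym (suc[q∸1]≡q k)) (proj₂ (bounds k N≤k)))

  charLetterCert⇒isCharLetter : ∀ {i ℓ} → CharLetterCert i ℓ → IsCharLetter α i ℓ
  charLetterCert⇒isCharLetter (flat c₁ c₂) = _ , floorCert⇒isFloor c₂ , floorCert⇒isFloor c₁
  charLetterCert⇒isCharLetter {i} (step {g} c₁ c₂) (m , ⌊⌋≡m₂ , ⌊⌋≡m₁) =
    1+n≢n (ℤP.+-injective (trans (sym (isFloor-unique {suc (suc i) ·ᵣ α} ⌊⌋≡m₂ (floorCert⇒isFloor c₂)))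
                                 (isFloor-unique {suc i ·ᵣ α} ⌊⌋≡m₁ (floorCert⇒isFloor c₁))))

  floorCert⇒floor-oneMinus : ∀ {j g} → FloorCert j g
    → Σ ℕ λ h → h + suc g ≡ j × IsFloor (j ·ᵣ oneMinus α) (ℤ.+ h)
  floorCert⇒floor-oneMinus {j} {g} cert with m≤n⇒∃[o]m+o≡n (floorCert-< cert)
  ... | h , g+1+h≡j = h , h+g+1≡j , floorCert⇒isFloor-oneMinus cert h+g+1≡j
    where
    h+g+1≡j : h + suc g ≡ j
    h+g+1≡j = trans (+-comm h (suc g)) g+1+h≡j

  charLetterCert⇒isCharLetter-oneMinus : ∀ {i ℓ} → CharLetterCert i ℓ
    → IsCharLetter (oneMinus α) i (swap ℓ)
  charLetterCert⇒isCharLetter-oneMinus {i} (flat {g} c₁ c₂) (m , ⌊⌋≡m₂ , ⌊⌋≡m₁)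
    with floorCert⇒floor-oneMinus c₁ | floorCert⇒floor-oneMinus c₂
  ... | h₁ , e₁ , ⌊⌋≡h₁ | h₂ , e₂ , ⌊⌋≡h₂ = 1+n≢n (trans (sym h₂≡1+h₁) h₂≡h₁)
    where
    h₂≡h₁ : h₂ ≡ h₁
    h₂≡h₁ = ℤP.+-injective (trans (sym (isFloor-unique {suc (suc i) ·ᵣ oneMinus α} ⌊⌋≡m₂ ⌊⌋≡h₂))
                                   (isFloor-unique {suc i ·ᵣ oneMinus α} ⌊⌋≡m₁ ⌊⌋≡h₁))
    h₂≡1+h₁ : h₂ ≡ suc h₁
    h₂≡1+h₁ = +-cancelʳ-≡ (suc g) h₂ (suc h₁) (trans e₂ (cong suc (sym e₁)))
  charLetterCert⇒isCharLetter-oneMinus {i} (step {g} c₁ c₂)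
    with floorCert⇒floor-oneMinus c₁ | floorCert⇒floor-oneMinus c₂
  ... | h₁ , e₁ , ⌊⌋≡h₁ | h₂ , e₂ , ⌊⌋≡h₂ =
    ℤ.+ h₁ , subst (λ h → IsFloor (suc (suc i) ·ᵣ oneMinus α) (ℤ.+ h)) h₂≡h₁ ⌊⌋≡h₂ , ⌊⌋≡h₁
    where
    h₂≡h₁ : h₂ ≡ h₁
    h₂≡h₁ = +-cancelʳ-≡ (suc g) h₂ h₁
      (suc-injective (trans (sym (+-suc h₂ (suc g))) (trans e₂ (cong suc (sym e₁)))))

  S-head : ∀ k → Σ Word λ w → S d (suc k) ≡ a ∷ w
  S-head zero    = [] , refl
  S-head (suc k) with S-head k
  ... | w , S≡a∷w = (w ++ pow (S d (suc k)) m) ++ S d k , (begin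
    pow (S d (suc k)) (d (suc k)) ++ S d k          ≡⟨ cong (λ e → pow (S d (suc k)) e ++ S d k) (sym 1+m≡d) ⟩
    (S d (suc k) ++ pow (S d (suc k)) m) ++ S d k   ≡⟨ cong (λ v → (v ++ pow (S d (suc k)) m) ++ S d k) S≡a∷w ⟩
    a ∷ (w ++ pow (S d (suc k)) m) ++ S d k         ∎)
    where
    open ≡-Reasoning
    m = d (suc k) ∸ 1
    1+m≡d : suc m ≡ d (suc k)
    1+m≡d = m+[n∸m]≡n (d-pos (suc k) (s≤s z≤n))

  S-shape : ∀ k → Σ Letter λ x → Σ Word λ w → S d (suc (suc k)) ≡ a ∷ x ∷ w
  S-shape k = second-letter (S d (suc (suc k))) (proj₂ (S-head (suc k)))
    (subst (2 ≤_) (sym (length-S (suc k))) (q≥2 k))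

θ : (ℕ → ℕ) → ℕ → Morphism
θ d j a = S d (suc j)
θ d j b = S d j

apply-θ-S : ∀ d j m → apply (θ d j) (S (λ i → d (i + j)) m) ≡ S d (m + j)
apply-θ-S d j zero          = ++-identityʳ (S d j)
apply-θ-S d j (suc zero)    = ++-identityʳ (S d (suc j))
apply-θ-S d j (suc (suc m)) = begin
  apply (θ d j) (pow (S d′ (suc m)) (d′ (suc m)) ++ S d′ m)
    ≡⟨ apply-++ (θ d j) (pow (S d′ (suc m)) (d′ (suc m))) (S d′ m) ⟩
  apply (θ d j) (pow (S d′ (suc m)) (d′ (suc m))) ++ apply (θ d j) (S d′ m)
    ≡⟨ cong (_++ apply (θ d j) (S d′ m)) (apply-pow (θ d j) (S d′ (suc m)) (d′ (suc m))) ⟩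
  pow (apply (θ d j) (S d′ (suc m))) (d′ (suc m)) ++ apply (θ d j) (S d′ m)
    ≡⟨ cong₂ (λ u v → pow u (d′ (suc m)) ++ v) (apply-θ-S d j (suc m)) (apply-θ-S d j m) ⟩
  pow (S d (suc m + j)) (d (suc m + j)) ++ S d (m + j)
    ∎
  where
  open ≡-Reasoning
  d′ : ℕ → ℕ
  d′ i = d (i + j)

module FixedPoint (l : ℕ) (d : ℕ → ℕ) (d-pos : ∀ k → 1 ≤ k → 1 ≤ d k)
  (d₁≤dₙ : d 1 ≤ d (suc (suc l))) (periodic : ∀ i → 2 ≤ i → d (i + suc l) ≡ d i) where

  open Convergents d d-pos

  n : ℕ
  n = suc (suc l)

  μ : Morphism
  μ a = a ∷ []
  μ b = pow (a ∷ []) (d n ∸ d 1) ++ b ∷ []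

  σ≡θ∘μ : ∀ x → σ d n x ≡ (θ d (suc l) ∘ₘ μ) x
  σ≡θ∘μ a = sym (++-identityʳ (S d n))
  σ≡θ∘μ b = sym (begin
    apply (θ d (suc l)) (pow (a ∷ []) (d n ∸ d 1) ++ b ∷ [])
      ≡⟨ apply-++ (θ d (suc l)) (pow (a ∷ []) (d n ∸ d 1)) (b ∷ []) ⟩
    apply (θ d (suc l)) (pow (a ∷ []) (d n ∸ d 1)) ++ S d (suc l) ++ []
      ≡⟨ cong₂ _++_ (apply-pow (θ d (suc l)) (a ∷ []) (d n ∸ d 1)) (++-identityʳ (S d (suc l))) ⟩
    pow (S d n ++ []) (d n ∸ d 1) ++ S d (suc l)
      ≡⟨ cong (λ w → pow w (d n ∸ d 1) ++ S d (suc l)) (++-identityʳ (S d n)) ⟩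
    pow (S d n) (d n ∸ d 1) ++ S d (suc l)
      ∎)
    where open ≡-Reasoning

  -- μ turns the partial quotients d₁, d₂, … into dₙ, d₂, …,
  -- which by periodicity are d_{1+(n−1)}, d_{2+(n−1)}, …
  apply-μ-S : ∀ m → apply μ (S d (suc m)) ≡ S (λ i → d (i + suc l)) (suc m)
  apply-μ-S zero          = refl
  apply-μ-S (suc zero)    = begin
    apply μ (pow (a ∷ []) (d 1) ++ b ∷ [])
      ≡⟨ apply-++ μ (pow (a ∷ []) (d 1)) (b ∷ []) ⟩
    apply μ (pow (a ∷ []) (d 1)) ++ μ b ++ []
      ≡⟨ cong₂ _++_ (apply-pow μ (a ∷ []) (d 1)) (++-identityʳ (μ b)) ⟩
    pow (a ∷ []) (d 1) ++ pow (a ∷ []) (d n ∸ d 1) ++ b ∷ []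
      ≡⟨ ++-assoc (pow (a ∷ []) (d 1)) (pow (a ∷ []) (d n ∸ d 1)) (b ∷ []) ⟨
    (pow (a ∷ []) (d 1) ++ pow (a ∷ []) (d n ∸ d 1)) ++ b ∷ []
      ≡⟨ cong (_++ b ∷ []) (pow-+ (a ∷ []) (d 1) (d n ∸ d 1)) ⟨
    pow (a ∷ []) (d 1 + (d n ∸ d 1)) ++ b ∷ []
      ≡⟨ cong (λ e → pow (a ∷ []) e ++ b ∷ []) (m+[n∸m]≡n d₁≤dₙ) ⟩
    pow (a ∷ []) (d n) ++ b ∷ []
      ∎
    where open ≡-Reasoning
  apply-μ-S (suc (suc m)) =
    trans (apply-++ μ (pow (S d (suc (suc m))) (d (suc (suc m)))) (S d (suc m)))
      (cong₂ _++_
        (trans (apply-pow μ (S d (suc (suc m))) (d (suc (suc m))))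
               (cong₂ pow (apply-μ-S (suc m)) (sym (periodic (suc (suc m)) (s≤s (s≤s z≤n))))))
        (apply-μ-S m))

  apply-σ-S : ∀ m → apply (σ d n) (S d (suc m)) ≡ S d (suc m + suc l)
  apply-σ-S m = begin
    apply (σ d n) (S d (suc m))                    ≡⟨ apply-cong σ≡θ∘μ (S d (suc m)) ⟩
    apply (θ d (suc l) ∘ₘ μ) (S d (suc m))         ≡⟨ apply-∘ₘ (θ d (suc l)) μ (S d (suc m)) ⟩
    apply (θ d (suc l)) (apply μ (S d (suc m)))    ≡⟨ cong (apply (θ d (suc l))) (apply-μ-S m) ⟩
    apply (θ d (suc l)) (S (λ i → d (i + suc l)) (suc m)) ≡⟨ apply-θ-S d (suc l) (suc m) ⟩
    S d (suc m + suc l)                            ∎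
    where open ≡-Reasoning

  iter-σ : ∀ m → iter (σ d n) m (a ∷ []) ≡ S d (suc (m * suc l))
  iter-σ zero    = refl
  iter-σ (suc m) = trans (cong (apply (σ d n)) (iter-σ m))
    (trans (apply-σ-S (m * suc l)) (cong (λ k → S d (suc k)) (+-comm (m * suc l) (suc l))))

  iter-σ̂ : ∀ m → iter (σ̂ d n) m (b ∷ []) ≡ apply E (iter (σ d n) m (a ∷ []))
  iter-σ̂ zero    = refl
  iter-σ̂ (suc m) = begin
    apply (σ̂ d n) (iter (σ̂ d n) m (b ∷ []))        ≡⟨ cong (apply (σ̂ d n)) (iter-σ̂ m) ⟩
    apply (E ∘ₘ (σ d n ∘ₘ E)) (apply E w)          ≡⟨ apply-∘ₘ E (σ d n ∘ₘ E) (apply E w) ⟩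
    apply E (apply (σ d n ∘ₘ E) (apply E w))       ≡⟨ cong (apply E) (apply-∘ₘ (σ d n) E (apply E w)) ⟩
    apply E (apply (σ d n) (apply E (apply E w)))  ≡⟨ cong (λ v → apply E (apply (σ d n) v)) (apply-E-involutive w) ⟩
    apply E (apply (σ d n) w)                      ∎
    where
    open ≡-Reasoning
    w = iter (σ d n) m (a ∷ [])

  length-iter-σ : ∀ m → m ≤ length (iter (σ d n) m (a ∷ []))
  length-iter-σ m = subst (m ≤_) (sym (trans (cong length (iter-σ m)) (length-S (m * suc l))))
    (≤-trans (m≤m*n m (suc l)) (<⇒≤ (q>k (m * suc l))))

  σ-fixedPoint : IsFixedPointOf (σ d n) a α
  σ-fixedPoint = S-shape l , (λ m → m , length-iter-σ m) , λ m →
    lookup-from-nth (iter (σ d n) m (a ∷ [])) (IsCharLetter α) λ i ℓ e →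
      charLetterCert⇒isCharLetter (certified-S (m * suc l) i ℓ (subst (λ w → nth w i ≡ just ℓ) (iter-σ m) e))

  σ̂-fixedPoint : IsFixedPointOf (σ̂ d n) b (oneMinus α)
  σ̂-fixedPoint = σ̂-shape , (λ m → m , length-iter-σ̂ m) , λ m →
    lookup-from-nth (iter (σ̂ d n) m (b ∷ [])) (IsCharLetter (oneMinus α)) (letter m)
    where
    σ̂-shape : Σ Letter λ x → Σ Word λ w → σ̂ d n b ≡ b ∷ x ∷ w
    σ̂-shape with S-shape l
    ... | x , w , e = swap x , apply E (w ++ []) , cong (λ v → apply E (v ++ [])) e
    length-iter-σ̂ : ∀ m → m ≤ length (iter (σ̂ d n) m (b ∷ []))
    length-iter-σ̂ m = subst (m ≤_)
      (sym (trans (cong length (iter-σ̂ m)) (length-apply-E (iter (σ d n) m (a ∷ []))))) (length-iter-σ m)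
    letter : ∀ m i ℓ → nth (iter (σ̂ d n) m (b ∷ [])) i ≡ just ℓ → IsCharLetter (oneMinus α) i ℓ
    letter m i ℓ e with nth-apply-E (iter (σ d n) m (a ∷ [])) i (subst (λ w → nth w i ≡ just ℓ) (iter-σ̂ m) e)
    ... | ℓ₀ , e₀ , refl = charLetterCert⇒isCharLetter-oneMinus
      (certified-S (m * suc l) i ℓ₀ (subst (λ w → nth w i ≡ just ℓ₀) (iter-σ m) e₀))

periodic-pos : ∀ l (d : ℕ → ℕ) → (∀ i → 1 ≤ i → i ≤ suc (suc l) → 1 ≤ d i)
  → (∀ i → 2 ≤ i → d (i + suc l) ≡ d i) → ∀ k → 1 ≤ k → 1 ≤ d k
periodic-pos l d pos periodic = <-rec (λ k → 1 ≤ k → 1 ≤ d k) step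
  where
  step : ∀ k → (∀ {i} → i < k → 1 ≤ i → 1 ≤ d i) → 1 ≤ k → 1 ≤ d k
  step k rec k≥1 with k ≤? suc (suc l)
  ... | yes k≤n = pos k k≥1 k≤n
  ... | no k≰n =
    subst (1 ≤_) (trans (sym (periodic i i≥2)) (cong d i+l+1≡k)) (rec i<k (≤-trans (s≤s z≤n) i≥2))
    where
    i = k ∸ suc l
    i≥2 : 2 ≤ i
    i≥2 = subst (_≤ i) (m+n∸n≡m 2 (suc l)) (∸-monoˡ-≤ (suc l) (≰⇒> k≰n))
    i+l+1≡k : i + suc l ≡ k
    i+l+1≡k = m∸n+n≡m (≤-trans (n≤1+n _) (≤-trans (n≤1+n _) (≰⇒> k≰n)))
    i<k : i < k
    i<k = subst (i <_) i+l+1≡k (m<m+n i (s≤s z≤n))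

corollary3p4 : (n : ℕ) → 2 ≤ n → (d : ℕ → ℕ)
    → (∀ i → 1 ≤ i → i ≤ n → 1 ≤ d i)
    → d 1 ≤ d n
    → (∀ i → 2 ≤ i → d (i + (n ∸ 1)) ≡ d i)
    → Irrational (cfValue d)
    → IsFixedPointOf (σ d n) a (cfValue d)
    × IsFixedPointOf (σ̂ d n) b (oneMinus (cfValue d))
corollary3p4 (suc (suc l)) (s≤s (s≤s z≤n)) d pos d₁≤dₙ periodic _ = σ-fixedPoint , σ̂-fixedPoint
  where open FixedPoint l d (periodic-pos l d pos periodic) d₁≤dₙ periodic
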